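{- Let $\overline{w}$ be a right-infinite word over a linearly ordered alphabet $\mathcal{A}$, let $n \geqslant 4$ be an integer, and let $w$ be a finite word over $\mathcal{A}$ such that $n-4 \leqslant |w| \leqslant n+6$ and $w_{0 \cdots n-5} = \overline{w}_{0 \cdots n-5}$. Let $\lambda$ be the number of $\overline{w}$-locally minimal integers that are smaller than $n$. Then $\lambda-4 \leqslant |\mathsf{eis}(w)| \leqslant \lambda+6$, and $\mathsf{eis}(w)_{0 \cdots \lambda-5} = \mathsf{eis}(\overline{w})_{0 \cdots \lambda-5}$ if $\lambda \geqslant 4$.
   Context: Words are indexed from $0$ and $w_{i \cdots j} = w_i \cdots w_j$. For a finite word $w$, a sentinel letter $\$ \notin \mathcal{A}$, smaller than every letter of $\mathcal{A}$, is set as $w_{|w|}$; an integer $i \leqslant |w|-1$ is $w$-non-decreasing if there is $j$ with $i+1 \leqslant j \leqslant |w|-1$ and $w_i = \cdots = w_{j-1} < w_j$; it is $w$-locally minimal if moreover $i \geqslant 1$ and $w_{i-1} > w_i$. If $i_0 < \cdots < i_{k-1}$ are the $w$-locally minimal integers and $i_k = |w|$, the unimodal factors of $w$ are $w_{i_0 \cdots i_1}, \ldots, w_{i_{k-1} \cdots i_k}$, and $\mathsf{eis}(w)$ is the length-$k$ word whose letters are these factors in order. For a right-infinite word $\overline{w}$ (no sentinel appended), an integer $i$ is $\overline{w}$-non-decreasing if there is $j > i$ with $\overline{w}_i = \cdots = \overline{w}_{j-1} < \overline{w}_j$, and $\overline{w}$-locally minimal if moreover $i \geqslant 1$ and $\overline{w}_{i-1}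 > \overline{w}_i$; if $i_0 < i_1 < \cdots$ are the $\overline{w}$-locally minimal integers, $\mathsf{eis}(\overline{w})$ is the word whose letters are the factors $\overline{w}_{i_0 \cdots i_1}, \overline{w}_{i_1 \cdots i_2}, \ldots$ in order. -}

module Defs where

open import Level using (Level)
open import Data.Nat using (ℕ; zero; suc; _+_; _∸_; _≤_; _<_)
open import Data.List using (List; []; _∷_; length; map; upTo)
open import Data.List.Membership.Propositional using (_∈_)
open import Data.List.Relation.Unary.Unique.Propositional using (Unique)
open import Data.Maybe using (Maybe; just; nothing)
open import Data.Product using (Σ; ∃; _×_)
open import Data.Sum using (_⊎_)
open import Data.Empty using (⊥)
open import Relation.Binary.Core using (Rel)
open import Relation.Binary.PropositionalEquality using (_≡_)

Count : ∀ {p} → (ℕ → Set p) → ℕ → ℕ → Set p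
Count P b k =
  Σ (List ℕ) λ xs →
    Unique xs
    × (∀ t → t ∈ xs → t < b × P t)
    × (∀ t → t < b → P t → t ∈ xs)
    × length xs ≡ k

range : ℕ → ℕ → List ℕ
range i j = map (i +_) (upTo (suc (j ∸ i)))

-- Finite word w ∈ List A. Letters are read in Maybe A :
-- position t < |w| gives just w_t, position |w| gives the sentinel nothing ($).
at : ∀ {a} {A : Set a} → List A → ℕ → Maybe A
at []       _       = nothing
at (x ∷ xs) zero    = just x
at (x ∷ xs) (suc t) = at xs t

module Words {a ℓ : Level} {A : Set a} (_≺_ : Rel A ℓ) where

  data _<ᴹ_ : Maybe A → Maybe A → Set (Level._⊔_ a ℓ) where
    $<just    : ∀ {x} → nothing <ᴹ just x
    just<just : ∀ {x y} → x ≺ y → just x <ᴹ just y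

  NonDecFin : List A → ℕ → Set (Level._⊔_ a ℓ)
  NonDecFin w i =
    i ≤ length w ∸ 1 ×
    ∃ λ j → suc i ≤ j × j ≤ length w ∸ 1
          × (∀ t → i ≤ t → t < j → at w t ≡ at w i)
          × at w i <ᴹ at w j

  LocMinFin : List A → ℕ → Set (Level._⊔_ a ℓ)
  LocMinFin w i = NonDecFin w i × 1 ≤ i × at w i <ᴹ at w (i ∸ 1)

  factorFin : List A → ℕ → ℕ → List (Maybe A)
  factorFin w i j = map (at w) (range i j)

  -- p = i_j, the j-th (0-indexed) w-locally minimal integer,
  -- or p = |w| = i_k when j = k is the number of them
  BoundFin : List A → ℕ → ℕ → Set _
  BoundFin w j p =
    (LocMinFin w p × Count (λ t → LocMinFin w t) p j)
    ⊎ (Count (λ t → LocMinFin w t) (length w) j × p ≡ length w)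

  NonDecInf : (ℕ → A) → ℕ → Set (Level._⊔_ a ℓ)
  NonDecInf w i =
    ∃ λ j → suc i ≤ j
          × (∀ t → i ≤ t → t < j → w t ≡ w i)
          × w i ≺ w j

  LocMinInf : (ℕ → A) → ℕ → Set (Level._⊔_ a ℓ)
  LocMinInf w i = NonDecInf w i × 1 ≤ i × w i ≺ w (i ∸ 1)

  factorInf : (ℕ → A) → ℕ → ℕ → List (Maybe A)
  factorInf w i j = map (λ t → just (w t)) (range i j)

  KthInf : (ℕ → A) → ℕ → ℕ → Set _
  KthInf w j q = LocMinInf w q × Count (λ t → LocMinInf w t) q j

module Submission where

-- Locally minimal integers are never adjacent, so a window of d positions contains at most ⌈d/2⌉
-- of them. If i < i′ are both locally minimal, the plateau starting at i ends by i′, so the local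
-- minimality of i is witnessed by letters before i′. As w and w̄ agree below N = n - 4, their
-- locally minimal integers below N therefore coincide, except possibly for the last one of each.
-- The counts λ (below N + 4) and k (below |w| ≤ N + 10) thus differ from the common count below N
-- by at most 2 + 1 and 5 + 1. For j + 5 ≤ λ, the j-th and (j+1)-th locally minimal
-- integers of w̄ are followed by another one below N, so they are also those of w, and the factor
-- between them lies in the common prefix.

open import Defs
open import Level using (Level; _⊔_)
open import Function.Base using (_∘_)
open import Function.Bundles using (mk⇔)
open import Data.Nat hiding (_⊔_)
open import Data.Nat.Properties
open import Data.List using (List; _∷_; length; filter; downFrom)
open import Data.List.Properties using (map-cong-local)
open import Data.List.Membership.Propositional using (_∈_)
open import Data.List.Membership.DecPropositional _≟_ using (_∈?_)
open import Data.List.Membership.Propositional.Properties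
  using (∈-filter⁺; ∈-filter⁻; ∈-downFrom⁺; ∈-downFrom⁻; ∈-map⁻; ∈-upTo⁻)
open import Data.List.Membership.Propositional.Properties.WithK using (unique∧set⇒bag)
open import Data.List.Relation.Unary.All using (tabulate)
open import Data.List.Relation.Unary.Unique.Propositional.Properties using (downFrom⁺; filter⁺)
open import Data.List.Relation.Binary.BagAndSetEquality using (∼bag⇒↭)
open import Data.List.Relation.Binary.Permutation.Propositional.Properties using (↭-length)
open import Data.Maybe using (Maybe; just; nothing)
open import Data.Maybe.Properties using (just-injective; ≡-dec)
open import Data.Product using (Σ; ∃; _×_; _,_; proj₂)
open import Data.Sum using (inj₁; inj₂)
open import Relation.Nullary using (¬_; Dec; yes; no; contradiction)
open import Relation.Nullary.Decidable using (map′; _×-dec_; _→-dec_)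
open import Relation.Unary using (Pred; Decidable)
open import Relation.Binary.Core using (Rel)
open import Relation.Binary.Definitions using (Irreflexive; Asymmetric)
open import Relation.Binary.Structures using (IsStrictTotalOrder)
open import Relation.Binary.PropositionalEquality

countBelow : ∀ {p} {P : Pred ℕ p} → Decidable P → ℕ → ℕ
countBelow P? b = length (filter P? (downFrom b))

module _ {p} {P : Pred ℕ p} (P? : Decidable P) where

  countBelow-Count : ∀ b → Count P b (countBelow P? b)
  countBelow-Count b = filter P? (downFrom b) , filter⁺ P? (downFrom⁺ b)
    , (λ t t∈ → let t∈↓ , Pt = ∈-filter⁻ P? t∈ in ∈-downFrom⁻ t∈↓ , Pt)
    , (λ t t<b Pt → ∈-filter⁺ P? (∈-downFrom⁺ t<b) Pt) , refl

  countBelow-+ : ∀ a d → countBelow P? (a + d) ≡ countBelow P? a + countBelow (P? ∘ (a +_)) d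
  countBelow-+ a zero = trans (cong (countBelow P?) (+-identityʳ a)) (sym (+-identityʳ _))
  countBelow-+ a (suc d) rewrite +-suc a d with P? (a + d)
  ... | yes _ = trans (cong suc (countBelow-+ a d)) (sym (+-suc _ _))
  ... | no _  = countBelow-+ a d

  countBelow-monoʳ : ∀ {a b} → a ≤ b → countBelow P? a ≤ countBelow P? b
  countBelow-monoʳ {a} {b} a≤b = begin
    countBelow P? a                                     ≤⟨ m≤m+n _ _ ⟩
    countBelow P? a + countBelow (P? ∘ (a +_)) (b ∸ a)  ≡⟨ countBelow-+ a (b ∸ a) ⟨
    countBelow P? (a + (b ∸ a))                         ≡⟨ cong (countBelow P?) (m+[n∸m]≡n a≤b) ⟩
    countBelow P? b                                     ∎
    where open ≤-Reasoning

  countBelow-<⇒< : ∀ {a b} → countBelow P? a < countBelow P? b → a < b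
  countBelow-<⇒< #a<#b = ≰⇒> λ b≤a → <⇒≱ #a<#b (countBelow-monoʳ b≤a)

  countBelow-select : ∀ {j} b → j < countBelow P? b → ∃ λ s → s < b × P s × countBelow P? s ≡ j
  countBelow-select (suc b) j<#b with P? b
  ... | no _ = let s , s<b , Ps , #s≡j = countBelow-select b j<#b in s , m≤n⇒m≤1+n s<b , Ps , #s≡j
  ... | yes Pb with m≤n⇒m<n∨m≡n (s≤s⁻¹ j<#b)
  ...   | inj₂ refl = b , ≤-refl , Pb , refl
  ...   | inj₁ j<#b′ = let s , s<b , Ps , #s≡j = countBelow-select b j<#b′ in s , m≤n⇒m≤1+n s<b , Ps , #s≡j

  countBelow-sparse : (∀ {t} → P t → ¬ P (suc t)) → ∀ b → countBelow P? b ≤ ⌈ b /2⌉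
  countBelow-sparse P-sparse zero = z≤n
  countBelow-sparse P-sparse (suc zero) with P? 0
  ... | yes _ = ≤-refl
  ... | no _  = z≤n
  countBelow-sparse P-sparse (suc (suc b)) with P? (suc b)
  ... | yes P1+b with P? b
  ...   | yes Pb = contradiction P1+b (P-sparse Pb)
  ...   | no _   = s≤s (countBelow-sparse P-sparse b)
  countBelow-sparse P-sparse (suc (suc b)) | no _ with P? b
  ...   | yes _ = s≤s (countBelow-sparse P-sparse b)
  ...   | no _  = m≤n⇒m≤1+n (countBelow-sparse P-sparse b)

countBelow-+-sparse : ∀ {p} {P : Pred ℕ p} (P? : Decidable P) → (∀ {t} → P t → ¬ P (suc t)) →
                      ∀ a d → countBelow P? (a + d) ≤ countBelow P? a + ⌈ d /2⌉
countBelow-+-sparse {P = P} P? P-sparse a d = begin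
  countBelow P? (a + d)                         ≡⟨ countBelow-+ P? a d ⟩
  countBelow P? a + countBelow (P? ∘ (a +_)) d  ≤⟨ +-monoʳ-≤ _ (countBelow-sparse (P? ∘ (a +_)) shifted-sparse d) ⟩
  countBelow P? a + ⌈ d /2⌉                     ∎
  where
  open ≤-Reasoning
  shifted-sparse : ∀ {t} → P (a + t) → ¬ P (a + suc t)
  shifted-sparse {t} Pa+t = P-sparse Pa+t ∘ subst P (+-suc a t)

module _ {p q} {P : Pred ℕ p} {Q : Pred ℕ q} (P? : Decidable P) (Q? : Decidable Q) where

  countBelow-mono : ∀ b → (∀ {t} → t < b → P t → Q t) → countBelow P? b ≤ countBelow Q? b
  countBelow-mono zero P⇒Q = z≤n
  countBelow-mono (suc b) P⇒Q with P? b | Q? b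
  ... | yes _  | yes _  = s≤s (countBelow-mono b (P⇒Q ∘ m≤n⇒m≤1+n))
  ... | yes Pb | no ¬Qb = contradiction (P⇒Q ≤-refl Pb) ¬Qb
  ... | no _   | yes _  = m≤n⇒m≤1+n (countBelow-mono b (P⇒Q ∘ m≤n⇒m≤1+n))
  ... | no _   | no _   = countBelow-mono b (P⇒Q ∘ m≤n⇒m≤1+n)

  countBelow-almost-mono : ∀ b → (∀ {i i′} → i < i′ → i′ < b → P i → P i′ → Q i) →
                           countBelow P? b ≤ suc (countBelow Q? b)
  countBelow-almost-mono zero _ = z≤n
  countBelow-almost-mono (suc b) P⇒Q with P? b
  ... | yes Pb = s≤s (≤-trans (countBelow-mono b λ t<b Pt → P⇒Q t<b ≤-refl Pt Pb)
                              (countBelow-monoʳ Q? (n≤1+n b)))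
  ... | no _   = ≤-trans (countBelow-almost-mono b λ i<i′ i′<b → P⇒Q i<i′ (m≤n⇒m≤1+n i′<b))
                         (s≤s (countBelow-monoʳ Q? (n≤1+n b)))

countBelow-cong : ∀ {p q} {P : Pred ℕ p} {Q : Pred ℕ q} (P? : Decidable P) (Q? : Decidable Q) b →
                  (∀ {t} → t < b → P t → Q t) → (∀ {t} → t < b → Q t → P t) →
                  countBelow P? b ≡ countBelow Q? b
countBelow-cong P? Q? b P⇒Q Q⇒P = ≤-antisym (countBelow-mono P? Q? b P⇒Q) (countBelow-mono Q? P? b Q⇒P)

Count-cong : ∀ {p r} {P : Pred ℕ p} {R : Pred ℕ r} {b k} →
             (∀ {t} → t < b → P t → R t) → (∀ {t} → t < b → R t → P t) → Count P b k → Count R b k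
Count-cong P⇒R R⇒P (xs , xs! , xs⊆ , ⊆xs , ∣xs∣) =
  xs , xs! , (λ t t∈xs → let t<b , Pt = xs⊆ t t∈xs in t<b , P⇒R t<b Pt)
     , (λ t t<b Rt → ⊆xs t t<b (R⇒P t<b Rt)) , ∣xs∣

Count-functional : ∀ {p} {P : Pred ℕ p} {b k l} → Count P b k → Count P b l → k ≡ l
Count-functional (xs , xs! , xs⊆ , ⊆xs , ∣xs∣) (ys , ys! , ys⊆ , ⊆ys , ∣ys∣) =
  trans (sym ∣xs∣) (trans (↭-length (∼bag⇒↭ (unique∧set⇒bag xs! ys! (mk⇔ xs⇒ys ys⇒xs)))) ∣ys∣)
  where
  xs⇒ys = λ {t} t∈xs → let t<b , Pt = xs⊆ t t∈xs in ⊆ys t t<b Pt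
  ys⇒xs = λ {t} t∈ys → let t<b , Pt = ys⊆ t t∈ys in ⊆xs t t<b Pt

module Linked {p q} {P : Pred ℕ p} {Q : Pred ℕ q} (P? : Decidable P) (Q? : Decidable Q) {N : ℕ}
  (P⇒Q : ∀ {i i′} → i < i′ → i′ < N → P i → P i′ → Q i)
  (Q⇒P : ∀ {i i′} → i < i′ → i′ < N → Q i → Q i′ → P i) where

  linked-countBelow : ∀ {s} → s < N → P s → Q s → countBelow P? s ≡ countBelow Q? s
  linked-countBelow s<N Ps Qs =
    countBelow-cong P? Q? _ (λ t<s Pt → P⇒Q t<s s<N Pt Ps) (λ t<s Qt → Q⇒P t<s s<N Qt Qs)

  linked-select : ∀ {j} → suc j < countBelow P? N →
                  ∃ λ s → s < N × P s × Q s × countBelow P? s ≡ j × countBelow Q? s ≡ j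
  linked-select {j} 1+j<#N
    with s , s<N , Ps , #s≡j ← countBelow-select P? N (<-trans (n<1+n j) 1+j<#N)
       | s′ , s′<N , Ps′ , #s′≡1+j ← countBelow-select P? N 1+j<#N
    = s , s<N , Ps , Qs , #s≡j , trans (sym (linked-countBelow s<N Ps Qs)) #s≡j
    where
    s<s′ = countBelow-<⇒< P? (subst₂ _<_ (sym #s≡j) (sym #s′≡1+j) (n<1+n j))
    Qs = P⇒Q s<s′ s′<N Ps Ps′

module LocalMinima {b ℓ} {B : Set b} {_⊏_ : Rel B ℓ}
                   (⊏-irrefl : Irreflexive _≡_ _⊏_) (⊏-asym : Asymmetric _⊏_) where
  open Words _⊏_ using (LocMinInf)

  locMin-sparse : ∀ {f t} → LocMinInf f t → ¬ LocMinInf f (suc t)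
  locMin-sparse {t = t} ((j , t<j , plateau , ft<fj) , _) (_ , _ , f1+t<ft) with suc t ≟ j
  ... | yes refl = ⊏-asym ft<fj f1+t<ft
  ... | no 1+t≢j = ⊏-irrefl (plateau (suc t) (n≤1+n t) (≤∧≢⇒< t<j 1+t≢j)) f1+t<ft

  plateau-ends-by-locMin : ∀ {f i i′ j} → i < i′ → (∀ t → i ≤ t → t < j → f t ≡ f i) →
                           LocMinInf f i′ → j ≤ i′
  plateau-ends-by-locMin {i′ = suc i′} {j} i<i′ plateau (_ , _ , fi′<fi′-1) with j ≤? suc i′
  ... | yes j≤i′ = j≤i′
  ... | no j≰i′ = contradiction fi′<fi′-1 (⊏-irrefl (trans (plateau (suc i′) (<⇒≤ i<i′) i′<j)
                                                             (sym (plateau i′ (s≤s⁻¹ i<i′) (<-trans (n<1+n i′) i′<j)))))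
    where i′<j = ≰⇒> j≰i′

  locMin-transfer : ∀ {f g N i i′} → (∀ {t} → t < N → f t ≡ g t) → i < i′ → i′ < N →
                    LocMinInf f i → LocMinInf f i′ → LocMinInf g i
  locMin-transfer {g = g} {i = i} f≡g i<i′ i′<N ((j , i<j , plateau , fi<fj) , 1≤i , fi<fi-1) locMin-i′ =
    (j , i<j , plateau-g , subst₂ _⊏_ (f≡g i<N) (f≡g j<N) fi<fj)
    , 1≤i , subst₂ _⊏_ (f≡g i<N) (f≡g i-1<N) fi<fi-1
    where
    i<N = <-trans i<i′ i′<N
    i-1<N = ≤-<-trans (m∸n≤m i 1) i<N
    j<N = ≤-<-trans (plateau-ends-by-locMin i<i′ plateau locMin-i′) i′<N
    plateau-g : ∀ t → i ≤ t → t < j → g t ≡ g i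
    plateau-g t i≤t t<j = trans (sym (f≡g (<-trans t<j j<N))) (trans (plateau t i≤t t<j) (f≡g i<N))

module Sentinel {a ℓ} {A : Set a} {_≺_ : Rel A ℓ} (sto : IsStrictTotalOrder _≡_ _≺_) where
  open IsStrictTotalOrder sto using (irrefl; asym) renaming (_<?_ to _≺?_; _≟_ to _≟ᴬ_)
  open Words _≺_

  LocMinᴹ : (ℕ → Maybe A) → ℕ → Set (a ⊔ ℓ)
  LocMinᴹ = Words.LocMinInf _<ᴹ_

  <ᴹ-irrefl : Irreflexive _≡_ _<ᴹ_
  <ᴹ-irrefl refl (just<just x≺x) = irrefl refl x≺x

  <ᴹ-asym : Asymmetric _<ᴹ_
  <ᴹ-asym (just<just x≺y) (just<just y≺x) = asym x≺y y≺x

  _<ᴹ?_ : ∀ x y → Dec (x <ᴹ y)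
  nothing <ᴹ? just _  = yes $<just
  nothing <ᴹ? nothing = no λ ()
  just _  <ᴹ? nothing = no λ ()
  just x  <ᴹ? just y  = map′ just<just (λ { (just<just x≺y) → x≺y }) (x ≺? y)

  open LocalMinima <ᴹ-irrefl <ᴹ-asym public

  just-≺⁻ : ∀ {x y} → just x <ᴹ just y → x ≺ y
  just-≺⁻ (just<just x≺y) = x≺y

  locMin-just⁺ : ∀ {w̄ i} → LocMinInf w̄ i → LocMinᴹ (just ∘ w̄) i
  locMin-just⁺ ((j , i<j , plateau , ≺j) , 1≤i , ≺i-1) =
    (j , i<j , (λ t i≤t t<j → cong just (plateau t i≤t t<j)) , just<just ≺j) , 1≤i , just<just ≺i-1

  locMin-just⁻ : ∀ {w̄ i} → LocMinᴹ (just ∘ w̄) i → LocMinInf w̄ i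
  locMin-just⁻ ((j , i<j , plateau , ≺j) , 1≤i , ≺i-1) =
    (j , i<j , (λ t i≤t t<j → just-injective (plateau t i≤t t<j)) , just-≺⁻ ≺j) , 1≤i , just-≺⁻ ≺i-1

  <ᴹ-at⇒< : ∀ {x} w j → x <ᴹ at w j → j < length w
  <ᴹ-at⇒< (_ ∷ _) zero    _  = s≤s z≤n
  <ᴹ-at⇒< (_ ∷ w) (suc j) lt = s≤s (<ᴹ-at⇒< w j lt)

  locMinFin⇒locMin : ∀ w {i} → LocMinFin w i → LocMinᴹ (at w) i
  locMinFin⇒locMin _ ((_ , j , i<j , _ , plateau , <j) , 1≤i , <i-1) =
    (j , i<j , plateau , <j) , 1≤i , <i-1

  -- The bounds of LocMinFin are automatic for the sequence at w: it is the sentinel from |w| on,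
  -- and the sentinel is above no letter.
  locMin⇒locMinFin : ∀ w {i} → LocMinᴹ (at w) i → LocMinFin w i
  locMin⇒locMinFin w ((j , i<j , plateau , <j) , 1≤i , <i-1) =
    (≤-trans (<⇒≤ i<j) j≤∣w∣-1 , j , i<j , j≤∣w∣-1 , plateau , <j) , 1≤i , <i-1
    where
    j≤∣w∣-1 = ∸-monoˡ-≤ 1 (<ᴹ-at⇒< w j <j)

  locMinFin? : ∀ w → Decidable (LocMinFin w)
  locMinFin? w i = ((i ≤? ∣w∣-1) ×-dec rises?) ×-dec (1 ≤? i) ×-dec (at w i <ᴹ? at w (i ∸ 1))
    where
    ∣w∣-1 = length w ∸ 1
    plateau? : ∀ j → Dec (∀ t → i ≤ t → t < j → at w t ≡ at w i)
    plateau? j = map′ (λ plateau t i≤t t<j → plateau t<j i≤t)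
                      (λ plateau {t} t<j i≤t → plateau t i≤t t<j)
      (allUpTo? (λ t → (i ≤? t) →-dec ≡-dec _≟ᴬ_ (at w t) (at w i)) j)
    rises? = map′ (λ (j , _ , rise) → j , rise) (λ (j , i<j , j≤ , rest) → j , s≤s j≤ , i<j , j≤ , rest)
      (anyUpTo? (λ j → (suc i ≤? j) ×-dec (j ≤? ∣w∣-1) ×-dec plateau? j ×-dec (at w i <ᴹ? at w j))
                (suc ∣w∣-1))

  range-bounded : ∀ {p p′ t} → p ≤ p′ → t ∈ range p p′ → t ≤ p′
  range-bounded {p} {p′} p≤p′ t∈ with i , i∈ , refl ← ∈-map⁻ (p +_) t∈ =
    ≤-trans (+-monoʳ-≤ p (s≤s⁻¹ (∈-upTo⁻ i∈))) (≤-reflexive (m+[n∸m]≡n p≤p′))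

  factorFin≡factorInf : ∀ {w̄} w {N p p′} → (∀ {t} → t < N → at w t ≡ just (w̄ t)) → p ≤ p′ → p′ < N →
                        factorFin w p p′ ≡ factorInf w̄ p p′
  factorFin≡factorInf _ agree p≤p′ p′<N =
    map-cong-local (tabulate λ t∈ → agree (≤-<-trans (range-bounded p≤p′ t∈) p′<N))

module PrefixAgreement {a ℓ} {A : Set a} {_≺_ : Rel A ℓ} (sto : IsStrictTotalOrder _≡_ _≺_)
  (w̄ : ℕ → A) (w : List A) {n : ℕ} (4≤n : 4 ≤ n) (agree : ∀ {t} → t < n ∸ 4 → at w t ≡ just (w̄ t))
  {p} {P : Pred ℕ p} (P? : Decidable P)
  (P⇒locMin : ∀ {t} → P t → Words.LocMinInf _≺_ w̄ t)
  (locMin⇒P : ∀ {t} → t < n ∸ 4 → Words.LocMinInf _≺_ w̄ t → P t) where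

  open Words _≺_
  open Sentinel sto

  N : ℕ
  N = n ∸ 4

  P⇒Q : ∀ {i i′} → i < i′ → i′ < N → P i → P i′ → LocMinFin w i
  P⇒Q i<i′ i′<N Pi Pi′ = locMin⇒locMinFin w
    (locMin-transfer (sym ∘ agree) i<i′ i′<N (locMin-just⁺ (P⇒locMin Pi)) (locMin-just⁺ (P⇒locMin Pi′)))

  Q⇒P : ∀ {i i′} → i < i′ → i′ < N → LocMinFin w i → LocMinFin w i′ → P i
  Q⇒P i<i′ i′<N Qi Qi′ = locMin⇒P (<-trans i<i′ i′<N) (locMin-just⁻
    (locMin-transfer agree i<i′ i′<N (locMinFin⇒locMin w Qi) (locMinFin⇒locMin w Qi′)))

  P-sparse : ∀ {t} → P t → ¬ P (suc t)
  P-sparse Pt = locMin-sparse (locMin-just⁺ (P⇒locMin Pt)) ∘ locMin-just⁺ ∘ P⇒locMin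

  Q-sparse : ∀ {t} → LocMinFin w t → ¬ LocMinFin w (suc t)
  Q-sparse Qt = locMin-sparse (locMinFin⇒locMin w Qt) ∘ locMinFin⇒locMin w

  Q? : Decidable (LocMinFin w)
  Q? = locMinFin? w

  open Linked P? Q? P⇒Q Q⇒P

  #P≤2+#P-N : countBelow P? n ≤ 2 + countBelow P? N
  #P≤2+#P-N = begin
    countBelow P? n        ≡⟨ cong (countBelow P?) (m∸n+n≡m 4≤n) ⟨
    countBelow P? (N + 4)  ≤⟨ countBelow-+-sparse P? P-sparse N 4 ⟩
    countBelow P? N + 2    ≡⟨ +-comm _ 2 ⟩
    2 + countBelow P? N    ∎
    where open ≤-Reasoning

  #P≤#Q+4 : N ≤ length w → countBelow P? n ≤ countBelow Q? (length w) + 4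
  #P≤#Q+4 N≤∣w∣ = begin
    countBelow P? n                     ≤⟨ #P≤2+#P-N ⟩
    2 + countBelow P? N                 ≤⟨ +-monoʳ-≤ 2 (countBelow-almost-mono P? Q? N P⇒Q) ⟩
    3 + countBelow Q? N                 ≤⟨ +-monoʳ-≤ 3 (countBelow-monoʳ Q? N≤∣w∣) ⟩
    3 + countBelow Q? (length w)        ≤⟨ +-monoˡ-≤ _ (n≤1+n 3) ⟩
    4 + countBelow Q? (length w)        ≡⟨ +-comm 4 _ ⟩
    countBelow Q? (length w) + 4        ∎
    where open ≤-Reasoning

  #Q≤#P+6 : length w ≤ n + 6 → countBelow Q? (length w) ≤ countBelow P? n + 6
  #Q≤#P+6 ∣w∣≤n+6 = begin
    countBelow Q? (length w)  ≤⟨ countBelow-monoʳ Q? ∣w∣≤N+10 ⟩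
    countBelow Q? (N + 10)    ≤⟨ countBelow-+-sparse Q? Q-sparse N 10 ⟩
    countBelow Q? N + 5       ≤⟨ +-monoˡ-≤ 5 (countBelow-almost-mono Q? P? N Q⇒P) ⟩
    suc (countBelow P? N) + 5 ≤⟨ +-monoˡ-≤ 5 (s≤s (countBelow-monoʳ P? (m∸n≤m n 4))) ⟩
    suc (countBelow P? n) + 5 ≡⟨ +-suc _ 5 ⟨
    countBelow P? n + 6       ∎
    where
    open ≤-Reasoning
    ∣w∣≤N+10 : length w ≤ N + 10
    ∣w∣≤N+10 = ≤-trans ∣w∣≤n+6 (≤-reflexive (trans (cong (_+ 6) (sym (m∸n+n≡m 4≤n))) (+-assoc N 4 6)))

  3+j≤#P-N : ∀ {j} → j + 5 ≤ countBelow P? n → 3 + j ≤ countBelow P? N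
  3+j≤#P-N {j} j+5≤#P = +-cancelˡ-≤ 2 _ _ (≤-trans (≤-reflexive (+-comm 5 j)) (≤-trans j+5≤#P #P≤2+#P-N))

  boundFin : ∀ {j s} → LocMinFin w s → countBelow Q? s ≡ j → BoundFin w j s
  boundFin Qs refl = inj₁ (Qs , countBelow-Count Q? _)

  kthInf : ∀ {j s} → s < N → P s → countBelow P? s ≡ j → KthInf w̄ j s
  kthInf s<N Ps refl =
    P⇒locMin Ps , Count-cong (λ _ → P⇒locMin) (λ t<s → locMin⇒P (<-trans t<s s<N)) (countBelow-Count P? _)

  prefix : ∀ {j} → j + 5 ≤ countBelow P? n →
           Σ ℕ λ p → Σ ℕ λ p′ → Σ ℕ λ q → Σ ℕ λ q′ →
             BoundFin w j p × BoundFin w (suc j) p′ × KthInf w̄ j q × KthInf w̄ (suc j) q′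
             × factorFin w p p′ ≡ factorInf w̄ q q′
  prefix {j} j+5≤#P =
    let s , s<N , Ps , Qs , #Ps≡j , #Qs≡j = linked-select (<-trans (n<1+n _) (3+j≤#P-N j+5≤#P))
        s′ , s′<N , Ps′ , Qs′ , #Ps′≡1+j , #Qs′≡1+j = linked-select (3+j≤#P-N j+5≤#P)
        s<s′ = countBelow-<⇒< P? (subst₂ _<_ (sym #Ps≡j) (sym #Ps′≡1+j) (n<1+n j))
    in s , s′ , s , s′ , boundFin Qs #Qs≡j , boundFin Qs′ #Qs′≡1+j
     , kthInf s<N Ps #Ps≡j , kthInf s′<N Ps′ #Ps′≡1+j , factorFin≡factorInf w agree (<⇒≤ s<s′) s′<N

lemma15 : ∀ {a ℓ : Level} {A : Set a} (_<_ : Rel A ℓ) → IsStrictTotalOrder _≡_ _<_ →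
    (w̄ : ℕ → A) (n : ℕ) (w : List A) →
    4 ≤ n → n ∸ 4 ≤ length w → length w ≤ n + 6 →
    (∀ t → t + 5 ≤ n → at w t ≡ just (w̄ t)) →
    (λ' : ℕ) → Count (λ t → Words.LocMinInf _<_ w̄ t) n λ' →
    ∃ λ k → Count (λ t → Words.LocMinFin _<_ w t) (length w) k
      × λ' ≤ k + 4 × k ≤ λ' + 6
      × (4 ≤ λ' → ∀ j → j + 5 ≤ λ' →
           Σ ℕ λ p → Σ ℕ λ p' → Σ ℕ λ q → Σ ℕ λ q' →
             Words.BoundFin _<_ w j p × Words.BoundFin _<_ w (suc j) p'
             × Words.KthInf _<_ w̄ j q × Words.KthInf _<_ w̄ (suc j) q'
             × Words.factorFin _<_ w p p' ≡ Words.factorInf _<_ w̄ q q')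
lemma15 _≺_ sto w̄ n w 4≤n N≤∣w∣ ∣w∣≤n+6 agree λ' λ'-count@(xs , _ , xs⊆ , ⊆xs , _) =
    k , countBelow-Count Q? (length w)
  , subst (_≤ k + 4) #P≡λ' (#P≤#Q+4 N≤∣w∣)
  , subst (k ≤_) (cong (_+ 6) #P≡λ') (#Q≤#P+6 ∣w∣≤n+6)
  , λ _ j → prefix ∘ subst (j + 5 ≤_) (sym #P≡λ')
  where
  agree< : ∀ {t} → t < n ∸ 4 → at w t ≡ just (w̄ t)
  agree< {t} t<N = agree t (subst (_≤ n) (sym (+-suc t 4)) (m≤o∸n⇒m+n≤o (suc t) 4≤n t<N))
  -- Local minimality in w̄ is undecidable; the locally minimal integers below n are decided by
  -- membership in the enumeration xs given with λ'.
  open PrefixAgreement sto w̄ w 4≤n agree< (_∈? xs) (proj₂ ∘ xs⊆ _)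
                       (λ t<N → ⊆xs _ (<-≤-trans t<N (m∸n≤m n 4)))
  k : ℕ
  k = countBelow Q? (length w)
  #P≡λ' : countBelow (_∈? xs) n ≡ λ'
  #P≡λ' = Count-functional (Count-cong (λ _ → proj₂ ∘ xs⊆ _) (⊆xs _) (countBelow-Count (_∈? xs) n))
                           λ'-count
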